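{- For all integers $n \geq 1$, $m \geq 0$ and $k \geq 0$, we have $D_{n,m,k} \leq \binom{\binom{n}{2} - \binom{k}{2}}{m} \cdot m!$.
   Context: A directed ordered acyclic graph (DOAG) is a tuple $(V, E, (\prec_v)_{v \in V \cup \{\emptyset\}})$ where $V$ is a finite set of vertices, $E \subseteq V \times V$ is a set of edges such that the directed graph $(V,E)$ is acyclic, for each $v \in V$, $\prec_v$ is a total order on the set of outgoing edges of $v$, and $\prec_\emptyset$ is a total order on the set of sources (vertices with no incoming edge). Two DOAGs are considered equal if there is a bijection between their vertex sets preserving the edges and all the orders. $D_{n,m,k}$ denotes the number of DOAGs with $n$ vertices, $m$ edges and $k$ sources. Convention: a binomial coefficient $\binom{a}{b}$ with $a < b$ is $0$. -}

module Defs where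

open import Data.Nat using (ℕ; _+_; _*_; _∸_; _≤_; _!)
open import Data.Nat.Combinatorics using (_C_)
open import Data.Fin using (Fin)
open import Data.Fin.Permutation using (Permutation′; _⟨$⟩ʳ_)
open import Data.List using (List; length; map; allFin)
open import Data.Nat.ListAction using (sum)
open import Data.List.Membership.Propositional using (_∈_; _∉_)
open import Data.List.Relation.Unary.Unique.Propositional using (Unique)
open import Data.List.Relation.Unary.All using (All)
open import Data.List.Relation.Unary.AllPairs using (AllPairs)
open import Data.Product using (_×_; Σ)
open import Relation.Binary.Construct.Closure.Transitive using (TransClosure)
open import Relation.Binary.PropositionalEquality using (_≡_)
open import Relation.Nullary using (¬_)

-- A DOAG on the vertex set Fin n.
-- out v lists the targets of the outgoing edges of v, in the order ≺_v
--   (no repetition, since E is a set of pairs);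
-- srcs lists the sources (vertices with no incoming edge) in the order ≺_∅.
record DOAG (n : ℕ) : Set where
  field
    out         : Fin n → List (Fin n)
    out-unique  : ∀ v → Unique (out v)
    srcs        : List (Fin n)
    srcs-unique : Unique srcs
    srcs-sound  : ∀ v → v ∈ srcs → ∀ u → v ∉ out u
    srcs-compl  : ∀ v → (∀ u → v ∉ out u) → v ∈ srcs
    acyclic     : ∀ v → ¬ TransClosure (λ x y → y ∈ out x) v v

open DOAG public

edges : ∀ {n} → DOAG n → ℕ
edges {n} G = sum (map (λ v → length (out G v)) (allFin n))

sources : ∀ {n} → DOAG n → ℕ
sources G = length (srcs G)

-- Two DOAGs are equal (isomorphic) if a bijection of the vertex sets
-- preserves the edges and all the orders.
Iso : ∀ {n} → DOAG n → DOAG n → Set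
Iso {n} G H = Σ (Permutation′ n) λ σ →
    (∀ v → out H (σ ⟨$⟩ʳ v) ≡ map (σ ⟨$⟩ʳ_) (out G v))
  × (srcs H ≡ map (σ ⟨$⟩ʳ_) (srcs G))

DistinctFamily : (n m k : ℕ) → List (DOAG n) → Set
DistinctFamily n m k L =
  All (λ G → edges G ≡ m × sources G ≡ k) L × AllPairs (λ G H → ¬ Iso G H) L

bound : ℕ → ℕ → ℕ → ℕ
bound n m k = ((n C 2 ∸ k C 2) C m) * (m !)

-- Choose a topological order of the DOAG that lists its k sources first, in the order ≺_∅,
-- and label every vertex by its position in that order. An edge then becomes a pair (a , b)
-- of labels with a < b < n and k ≤ b (its target is not a source), and there are
-- C(n,2) - C(k,2) such pairs. Listing the labelled edges vertex by vertex, the out-edges of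
-- each vertex in the order ≺_v, gives a duplicate-free list of m such pairs from which the
-- DOAG is recovered up to isomorphism: the out-list of the vertex labelled c consists of the
-- second components of the pairs starting at c. Hence non-isomorphic DOAGs give distinct
-- lists, of which there are at most N (N - 1) ⋯ (N - m + 1) ≤ C(N,m) m!, N = C(n,2) - C(k,2).

module Submission where

open import Defs

import Algebra.Properties.CommutativeSemigroup as CommSemigroupProperties
open import Data.Empty using (⊥-elim)
open import Data.Fin as Fin using (Fin; toℕ)
open import Data.Fin.Permutation
  using (Permutation; Permutation′; permutation; flip; _∘ₚ_; cast-id; refute;
         _⟨$⟩ʳ_; _⟨$⟩ˡ_; inverseˡ; inverseʳ)
open import Data.Fin.Properties using (any?; toℕ-cast; toℕ-injective; toℕ<n) renaming (_≟_ to _≟ᶠ_)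
open import Data.List
  using (List; []; _∷_; _++_; length; map; concat; concatMap; filter; lookup; applyUpTo; upTo; allFin)
open import Data.List.Membership.Propositional using (_∈_; _∉_; mapWith∈; find)
open import Data.List.Membership.Propositional.Properties
  using (∈-++⁺ˡ; ∈-++⁺ʳ; ∈-++⁻; ∈-map⁺; ∈-map⁻; ∈-concat⁺′; ∈-upTo⁺; ∈-allFin; ∈-lookup;
         ∈-filter⁺; ∈-filter⁻)
open import Data.List.Membership.Propositional.Properties.WithK using (unique⇒irrelevant)
open import Data.List.Properties
  using (length-++; length-map; length-upTo; length-removeAt; length-removeAt′; length-tabulate;
         map-++; map-∘; map-cong; map-injective; filter-++; filter-all; filter-none; ++-identityʳ)
open import Data.List.Relation.Binary.Subset.Propositional using (_⊆_)
open import Data.List.Relation.Unary.All as All using (All; []; _∷_; all?)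
open import Data.List.Relation.Unary.All.Properties using (¬All⇒Any¬; ¬Any⇒All¬) renaming (map⁺ to All-map⁺)
open import Data.List.Relation.Unary.AllPairs using (AllPairs; []; _∷_)
import Data.List.Relation.Unary.AllPairs.Properties as AllPairs
open import Data.List.Relation.Unary.Any using (here; there; index; _─_)
open import Data.List.Relation.Unary.Any.Properties using (lookup-index)
open import Data.List.Relation.Unary.Unique.Propositional using (Unique)
import Data.List.Relation.Unary.Unique.Propositional.Properties as Unique
open import Data.Nat using (ℕ; zero; suc; pred; _+_; _*_; _∸_; _≤_; _<_; z≤n; s≤s; _!; _≟_)
open import Data.Nat.Combinatorics using (_C_; nC1≡n; nCk+nC[k+1]≡[n+1]C[k+1])
open import Data.Nat.ListAction using (sum)
open import Data.Nat.Properties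
  using (≤-refl; <⇒≤; <⇒≱; n≮n; <-cmp; +-comm; +-suc; +-identityʳ; +-mono-≤; *-monoˡ-≤; *-monoʳ-≤;
         *-distribʳ-+; m≤m+n; m≤n+m∸n; 0∸n≡0; m∸n+n≡m; m+n∸n≡m; m<1+n⇒m<n∨m≡n;
         +-commutativeSemigroup; *-commutativeSemigroup; module ≤-Reasoning)
open import Data.Product using (_×_; _,_; proj₁; proj₂; ∃-syntax)
open import Data.Sum using (inj₁; inj₂)
open import Function using (_∘_)
open import Function.Definitions using (Injective)
open import Relation.Binary.Construct.Closure.Transitive using (TransClosure; [_]; _∷ʳ_)
open import Relation.Binary.Definitions using (tri<; tri≈; tri>)
open import Relation.Binary.PropositionalEquality
  using (_≡_; _≢_; refl; sym; trans; cong; cong₂; subst; subst₂; module ≡-Reasoning)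
open import Relation.Nullary using (¬_; yes; no; ¬?)
open import Relation.Nullary.Decidable using (decidable-stable)
open import Relation.Unary using (Decidable)

open CommSemigroupProperties *-commutativeSemigroup using (x∙yz≈y∙xz)
open CommSemigroupProperties +-commutativeSemigroup using (xy∙z≈xz∙y)

module _ {A : Set} where

  ∈-─⁺ : ∀ {x y : A} {ys} (p : x ∈ ys) → y ∈ ys → y ≢ x → y ∈ (ys ─ p)
  ∈-─⁺ (here refl) (here refl) y≢x = ⊥-elim (y≢x refl)
  ∈-─⁺ (here _)    (there q)   _   = q
  ∈-─⁺ (there _)   (here q)    _   = here q
  ∈-─⁺ (there p)   (there q)   y≢x = there (∈-─⁺ p q y≢x)

  ⊆-─⁺ : ∀ {x : A} {xs ys} → All (x ≢_) xs → xs ⊆ ys → (p : x ∈ ys) → xs ⊆ (ys ─ p)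
  ⊆-─⁺ x∉xs xs⊆ys p q = ∈-─⁺ p (xs⊆ys q) (λ y≡x → All.lookup x∉xs q (sym y≡x))

  unique∧⊆⇒length≤ : ∀ {xs ys : List A} → Unique xs → xs ⊆ ys → length xs ≤ length ys
  unique∧⊆⇒length≤ {[]}          _                  _     = z≤n
  unique∧⊆⇒length≤ {x ∷ xs} {ys} (x∉xs ∷ xs-unique) xs⊆ys = begin
    suc (length xs)        ≤⟨ s≤s (unique∧⊆⇒length≤ xs-unique (⊆-─⁺ x∉xs (λ q → xs⊆ys (there q)) p)) ⟩
    suc (length (ys ─ p))  ≡⟨ length-removeAt′ ys (index p) ⟨
    length ys              ∎
    where
    open ≤-Reasoning
    p = xs⊆ys (here refl)

  ∈-mapWith∈ : ∀ {B : Set} {x} {xs : List A} (f : ∀ {y} → y ∈ xs → B) (p : x ∈ xs) →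
               f p ∈ mapWith∈ xs f
  ∈-mapWith∈ f (here refl) = here refl
  ∈-mapWith∈ f (there p)   = there (∈-mapWith∈ (λ q → f (there q)) p)

  length-concat-mapWith∈ : ∀ {B : Set} (xs : List A) (f : ∀ {y} → y ∈ xs → List B) {c} →
                           (∀ {y} (p : y ∈ xs) → length (f p) ≡ c) →
                           length (concat (mapWith∈ xs f)) ≡ length xs * c
  length-concat-mapWith∈ []       _ _ = refl
  length-concat-mapWith∈ (_ ∷ xs) f h = trans (length-++ (f (here refl)))
    (cong₂ _+_ (h (here refl)) (length-concat-mapWith∈ xs (λ q → f (there q)) (λ q → h (there q))))

  injections : List A → ℕ → List (List A)
  injections U zero    = [] ∷ []
  injections U (suc m) = concat (mapWith∈ U λ {x} x∈U → map (x ∷_) (injections (U ─ x∈U) m))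

  ∈-injections : ∀ {U xs : List A} → Unique xs → xs ⊆ U → xs ∈ injections U (length xs)
  ∈-injections {xs = []}     _                 _    = here refl
  ∈-injections {U} {x ∷ xs} (x∉xs ∷ xs-unique) xs⊆U =
    ∈-concat⁺′ (∈-map⁺ (x ∷_) (∈-injections xs-unique (⊆-─⁺ x∉xs (λ q → xs⊆U (there q)) x∈U)))
               (∈-mapWith∈ _ x∈U)
    where x∈U = xs⊆U (here refl)

_↓_ : ℕ → ℕ → ℕ
N ↓ zero  = 1
N ↓ suc m = N * (pred N ↓ m)

length-injections : ∀ {A : Set} (U : List A) m → length (injections U m) ≡ length U ↓ m
length-injections U zero    = refl
length-injections U (suc m) = length-concat-mapWith∈ U _ λ {x} x∈U → begin
  length (map (x ∷_) (injections (U ─ x∈U) m))  ≡⟨ length-map (x ∷_) (injections (U ─ x∈U) m) ⟩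
  length (injections (U ─ x∈U) m)               ≡⟨ length-injections (U ─ x∈U) m ⟩
  length (U ─ x∈U) ↓ m                          ≡⟨ cong (_↓ m) (length-removeAt U (index x∈U)) ⟩
  pred (length U) ↓ m                           ∎
  where open ≡-Reasoning

↓-suc : ∀ N m → N ↓ suc m ≡ (N ∸ m) * (N ↓ m)
↓-suc zero    m       = sym (cong (_* (0 ↓ m)) (0∸n≡0 m))
↓-suc (suc N) zero    = refl
↓-suc (suc N) (suc m) = begin
  suc N * (N ↓ suc m)          ≡⟨ cong (suc N *_) (↓-suc N m) ⟩
  suc N * ((N ∸ m) * (N ↓ m))  ≡⟨ x∙yz≈y∙xz (suc N) (N ∸ m) (N ↓ m) ⟩
  (N ∸ m) * (suc N * (N ↓ m))  ∎
  where open ≡-Reasoning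

↓≤C*! : ∀ N m → N ↓ m ≤ (N C m) * m !
↓≤C*! N       zero    = ≤-refl
↓≤C*! zero    (suc m) = z≤n
-- Pascal's rule; the first step is an inequality because N ∸ m truncates when N < m.
↓≤C*! (suc N) (suc m) = begin
  suc N * (N ↓ m)
    ≤⟨ *-monoˡ-≤ (N ↓ m) (m≤n+m∸n (suc N) (suc m)) ⟩
  (suc m + (N ∸ m)) * (N ↓ m)
    ≡⟨ *-distribʳ-+ (N ↓ m) (suc m) (N ∸ m) ⟩
  suc m * (N ↓ m) + (N ∸ m) * (N ↓ m)
    ≡⟨ cong (suc m * (N ↓ m) +_) (↓-suc N m) ⟨
  suc m * (N ↓ m) + N ↓ suc m
    ≤⟨ +-mono-≤ (*-monoʳ-≤ (suc m) (↓≤C*! N m)) (↓≤C*! N (suc m)) ⟩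
  suc m * ((N C m) * m !) + (N C suc m) * (suc m) !
    ≡⟨ cong (_+ (N C suc m) * (suc m) !) (x∙yz≈y∙xz (suc m) (N C m) (m !)) ⟩
  (N C m) * (suc m) ! + (N C suc m) * (suc m) !
    ≡⟨ *-distribʳ-+ ((suc m) !) (N C m) (N C suc m) ⟨
  (N C m + N C suc m) * (suc m) !
    ≡⟨ cong (_* (suc m) !) (nCk+nC[k+1]≡[n+1]C[k+1] N m) ⟩
  (suc N C suc m) * (suc m) !
    ∎
  where open ≤-Reasoning

edgeSlots : ℕ → ℕ → List (ℕ × ℕ)
edgeSlots k zero    = []
edgeSlots k (suc d) = edgeSlots k d ++ map (λ a → a , d + k) (upTo (d + k))

∈-edgeSlots : ∀ {a b} k d → a < b → k ≤ b → b < d + k → (a , b) ∈ edgeSlots k d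
∈-edgeSlots k zero    a<b k≤b b<k   = ⊥-elim (<⇒≱ b<k k≤b)
∈-edgeSlots k (suc d) a<b k≤b b<1+d+k with m<1+n⇒m<n∨m≡n b<1+d+k
... | inj₁ b<d+k = ∈-++⁺ˡ (∈-edgeSlots k d a<b k≤b b<d+k)
... | inj₂ refl  = ∈-++⁺ʳ (edgeSlots k d) (∈-map⁺ (λ a → a , d + k) (∈-upTo⁺ a<b))

length-edgeSlots : ∀ k d → length (edgeSlots k d) + k C 2 ≡ (d + k) C 2
length-edgeSlots k zero    = refl
length-edgeSlots k (suc d) = begin
  length (edgeSlots k d ++ map _ (upTo (d + k))) + k C 2  ≡⟨ cong (_+ k C 2) length-step ⟩
  length (edgeSlots k d) + (d + k) + k C 2               ≡⟨ xy∙z≈xz∙y (length (edgeSlots k d)) (d + k) (k C 2) ⟩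
  length (edgeSlots k d) + k C 2 + (d + k)               ≡⟨ cong (_+ (d + k)) (length-edgeSlots k d) ⟩
  (d + k) C 2 + (d + k)                                  ≡⟨ +-comm ((d + k) C 2) (d + k) ⟩
  (d + k) + (d + k) C 2                                  ≡⟨ cong (_+ (d + k) C 2) (nC1≡n (d + k)) ⟨
  (d + k) C 1 + (d + k) C 2                              ≡⟨ nCk+nC[k+1]≡[n+1]C[k+1] (d + k) 1 ⟩
  suc (d + k) C 2                                        ∎
  where
  open ≡-Reasoning
  length-step : length (edgeSlots k d ++ map (λ a → a , d + k) (upTo (d + k))) ≡ length (edgeSlots k d) + (d + k)
  length-step = trans (length-++ (edgeSlots k d))
    (cong (length (edgeSlots k d) +_) (trans (length-map _ (upTo (d + k))) (length-upTo (d + k))))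

module _ {n : ℕ} where

  open import Data.List.Membership.DecPropositional (_≟ᶠ_ {n}) using (_∈?_)

  unique⇒length≤ : {xs : List (Fin n)} → Unique xs → length xs ≤ n
  unique⇒length≤ {xs} xs-unique =
    subst (length xs ≤_) (length-tabulate _) (unique∧⊆⇒length≤ xs-unique (λ {x} _ → ∈-allFin x))

  short⇒∃∉ : (xs : List (Fin n)) → length xs < n → ∃[ v ] v ∉ xs
  short⇒∃∉ xs |xs|<n with any? (λ v → ¬? (v ∈? xs))
  ... | yes ∃v∉xs = ∃v∉xs
  ... | no ∄v∉xs  = ⊥-elim (<⇒≱ |xs|<n (subst (_≤ length xs) (length-tabulate _)
    (unique∧⊆⇒length≤ (Unique.allFin⁺ n) allFin⊆xs)))
    where
    allFin⊆xs : allFin n ⊆ xs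
    allFin⊆xs {v} _ = decidable-stable (v ∈? xs) (λ v∉xs → ∄v∉xs (v , v∉xs))

  unique∧length≡⇒∈ : {xs : List (Fin n)} → Unique xs → length xs ≡ n → ∀ v → v ∈ xs
  unique∧length≡⇒∈ {xs} xs-unique |xs|≡n v with v ∈? xs
  ... | yes v∈xs = v∈xs
  ... | no v∉xs  =
    ⊥-elim (n≮n n (subst (λ l → suc l ≤ n) |xs|≡n (unique⇒length≤ (¬Any⇒All¬ xs v∉xs ∷ xs-unique))))

TopologicallySorted : ∀ {n} → (Fin n → List (Fin n)) → List (Fin n) → Set
TopologicallySorted adj = AllPairs (λ u v → u ∉ adj v)

module TopologicalSort {n : ℕ} (adj : Fin n → List (Fin n))
  (acyclic : ∀ v → ¬ TransClosure (λ x y → y ∈ adj x) v v) where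

  open import Data.List.Membership.DecPropositional (_≟ᶠ_ {n}) using (_∈?_)

  _⇝_ : Fin n → Fin n → Set
  _⇝_ = TransClosure (λ x y → y ∈ adj x)

  Closed : List (Fin n) → Set
  Closed Q = ∀ {v} → v ∈ Q → adj v ⊆ Q

  ∃-exit : (Q : List (Fin n)) → ∀ {v} → v ∉ Q → ∃[ x ] x ∉ Q × adj x ⊆ Q
  ∃-exit Q v∉Q = walk n _ [] v∉Q (All.tabulate (λ ()) ∷ []) (λ ()) ≤-refl
    where
    -- Walk along edges leaving Q. Every visited vertex reaches the current one, so by
    -- acyclicity no vertex is visited twice and the walk stops within n steps.
    walk : ∀ fuel c (path : List (Fin n)) → c ∉ Q → Unique (c ∷ path) →
           (∀ {x} → x ∈ path → x ⇝ c) → n ≤ length path + fuel → ∃[ x ] x ∉ Q × adj x ⊆ Q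
    walk zero _ _ _ c∷path-unique _ n≤|path|+0 =
      ⊥-elim (<⇒≱ (unique⇒length≤ c∷path-unique) (subst (n ≤_) (+-identityʳ _) n≤|path|+0))
    walk (suc fuel) c path c∉Q c∷path-unique path⇝c n≤ with all? (_∈? Q) (adj c)
    ... | yes adj-c⊆Q = c , c∉Q , All.lookup adj-c⊆Q
    ... | no adj-c⊈Q with find (¬All⇒Any¬ (_∈? Q) (adj c) adj-c⊈Q)
    ...   | w , w∈adj-c , w∉Q =
      walk fuel w (c ∷ path) w∉Q (All.tabulate w≢ ∷ c∷path-unique) c∷path⇝w
           (subst (n ≤_) (+-suc (length path) fuel) n≤)
      where
      c∷path⇝w : ∀ {x} → x ∈ c ∷ path → x ⇝ w
      c∷path⇝w (here refl) = [ w∈adj-c ]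
      c∷path⇝w (there p)   = path⇝c p ∷ʳ w∈adj-c
      w≢ : ∀ {x} → x ∈ c ∷ path → w ≢ x
      w≢ p refl = acyclic w (c∷path⇝w p)

  sortedClosed : ∀ j → j ≤ n →
    ∃[ Q ] Unique Q × Closed Q × TopologicallySorted adj Q × length Q ≡ j
  sortedClosed zero    _   = [] , [] , (λ ()) , [] , refl
  sortedClosed (suc j) j<n with sortedClosed j (<⇒≤ j<n)
  ... | Q , Q-unique , Q-closed , Q-sorted , refl with short⇒∃∉ Q j<n
  ...   | _ , v∉Q with ∃-exit Q v∉Q
  ...     | x , x∉Q , adj-x⊆Q =
    x ∷ Q , ¬Any⇒All¬ Q x∉Q ∷ Q-unique , x∷Q-closed ,
    All.tabulate (λ y∈Q x∈adj-y → x∉Q (Q-closed y∈Q x∈adj-y)) ∷ Q-sorted , refl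
    where
    x∷Q-closed : Closed (x ∷ Q)
    x∷Q-closed (here refl) u∈adj = there (adj-x⊆Q u∈adj)
    x∷Q-closed (there y∈Q) u∈adj = there (Q-closed y∈Q u∈adj)

  record TopologicalOrder : Set where
    field
      order        : List (Fin n)
      order-unique : Unique order
      ∈-order      : ∀ v → v ∈ order
      order-sorted : TopologicallySorted adj order

  topologicalSort : TopologicalOrder
  topologicalSort with sortedClosed n ≤-refl
  ... | T , T-unique , _ , T-sorted , |T|≡n = record
    { order        = T
    ; order-unique = T-unique
    ; ∈-order      = unique∧length≡⇒∈ T-unique |T|≡n
    ; order-sorted = T-sorted
    }

module _ {A : Set} where

  index-∈-lookup : ∀ {xs : List A} i → index (∈-lookup {xs = xs} i) ≡ i
  index-∈-lookup {_ ∷ _} Fin.zero    = refl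
  index-∈-lookup {_ ∷ _} (Fin.suc i) = cong Fin.suc (index-∈-lookup i)

  toℕ-index-++⁺ˡ : ∀ {x : A} {xs ys} (p : x ∈ xs) →
                   toℕ (index (∈-++⁺ˡ {ys = ys} p)) ≡ toℕ (index p)
  toℕ-index-++⁺ˡ (here _)  = refl
  toℕ-index-++⁺ˡ (there p) = cong suc (toℕ-index-++⁺ˡ p)

  toℕ-index-++⁺ʳ : ∀ {x : A} xs {ys} (q : x ∈ ys) →
                   toℕ (index (∈-++⁺ʳ xs q)) ≡ length xs + toℕ (index q)
  toℕ-index-++⁺ʳ []       _ = refl
  toℕ-index-++⁺ʳ (_ ∷ xs) q = cong suc (toℕ-index-++⁺ʳ xs q)

  map≡applyUpTo-index : ∀ {B : Set} {f : A → B} {g : ℕ → B} (xs : List A) →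
    (∀ {x} (p : x ∈ xs) → f x ≡ g (toℕ (index p))) → map f xs ≡ applyUpTo g (length xs)
  map≡applyUpTo-index []       _ = refl
  map≡applyUpTo-index (_ ∷ xs) h = cong₂ _∷_ (h (here refl)) (map≡applyUpTo-index xs (λ p → h (there p)))

  AllPairs-index : ∀ {R : A → A → Set} {xs x y} → AllPairs R xs →
    (p : x ∈ xs) (q : y ∈ xs) → toℕ (index p) < toℕ (index q) → R x y
  AllPairs-index (r ∷ _)  (here refl) (there q) _         = All.lookup r q
  AllPairs-index (_ ∷ rs) (there p)   (there q) (s≤s p<q) = AllPairs-index rs p q p<q

  AllPairs-++⁺-minimal : ∀ {R : A → A → Set} {xs ys} →
    All (λ x → ∀ y → R x y) xs → AllPairs R ys → AllPairs R (xs ++ ys)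
  AllPairs-++⁺-minimal []       ys-pairs = ys-pairs
  AllPairs-++⁺-minimal (r ∷ rs) ys-pairs = All.universal r _ ∷ AllPairs-++⁺-minimal rs ys-pairs

module _ {n : ℕ} (G : DOAG n) where

  open import Data.List.Membership.DecPropositional (_≟ᶠ_ {n}) using (_∈?_)
  open TopologicalSort (out G) (acyclic G) using (topologicalSort; module TopologicalOrder)
  open TopologicalOrder topologicalSort

  nonSource? : Decidable (_∉ srcs G)
  nonSource? v = ¬? (v ∈? srcs G)

  nonSources : List (Fin n)
  nonSources = filter nonSource? order

  vertexOrder : List (Fin n)
  vertexOrder = srcs G ++ nonSources

  vertexOrder-unique : Unique vertexOrder
  vertexOrder-unique = Unique.++⁺ (srcs-unique G) (Unique.filter⁺ nonSource? order-unique)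
    λ (v∈srcs , v∈nonSources) → proj₂ (∈-filter⁻ nonSource? {xs = order} v∈nonSources) v∈srcs

  ∈-nonSources : ∀ {v} → v ∉ srcs G → v ∈ nonSources
  ∈-nonSources {v} v∉srcs = ∈-filter⁺ nonSource? (∈-order v) v∉srcs

  ∈-vertexOrder : ∀ v → v ∈ vertexOrder
  ∈-vertexOrder v with v ∈? srcs G
  ... | yes v∈srcs = ∈-++⁺ˡ v∈srcs
  ... | no  v∉srcs = ∈-++⁺ʳ (srcs G) (∈-nonSources v∉srcs)

  vertexOrder-sorted : TopologicallySorted (out G) vertexOrder
  vertexOrder-sorted = AllPairs-++⁺-minimal (All.tabulate λ s∈srcs v → srcs-sound G _ s∈srcs v)
    (AllPairs.filter⁺ nonSource? order-sorted)

  enumeration : Permutation (length vertexOrder) n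
  enumeration = permutation (lookup vertexOrder) (λ v → index (∈-vertexOrder v))
    (λ v → sym (lookup-index (∈-vertexOrder v)))
    (λ i → trans (cong index (unique⇒irrelevant vertexOrder-unique _ (∈-lookup i))) (index-∈-lookup i))

  length-vertexOrder : length vertexOrder ≡ n
  length-vertexOrder = decidable-stable (length vertexOrder ≟ n) (λ ≢n → refute ≢n enumeration)

  label : Permutation′ n
  label = flip enumeration ∘ₚ cast-id length-vertexOrder

  position : Fin n → ℕ
  position v = toℕ (label ⟨$⟩ʳ v)

  position≡index : ∀ {v} (p : v ∈ vertexOrder) → position v ≡ toℕ (index p)
  position≡index {v} p = trans (toℕ-cast length-vertexOrder (index (∈-vertexOrder v)))
    (cong (toℕ ∘ index) (unique⇒irrelevant vertexOrder-unique (∈-vertexOrder v) p))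

  position-injective : Injective _≡_ _≡_ position
  position-injective {v} {w} eq = begin
    v                              ≡⟨ inverseˡ label ⟨
    label ⟨$⟩ˡ (label ⟨$⟩ʳ v)      ≡⟨ cong (label ⟨$⟩ˡ_) (toℕ-injective eq) ⟩
    label ⟨$⟩ˡ (label ⟨$⟩ʳ w)      ≡⟨ inverseˡ label ⟩
    w                              ∎
    where open ≡-Reasoning

  map-position-srcs : map position (srcs G) ≡ upTo (sources G)
  map-position-srcs = map≡applyUpTo-index (srcs G) λ p →
    trans (position≡index (∈-++⁺ˡ p)) (toℕ-index-++⁺ˡ p)

  sources≤position : ∀ {v} → v ∉ srcs G → sources G ≤ position v
  sources≤position v∉srcs = subst (sources G ≤_)
    (sym (trans (position≡index (∈-++⁺ʳ (srcs G) p)) (toℕ-index-++⁺ʳ (srcs G) p))) (m≤m+n _ _)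
    where p = ∈-nonSources v∉srcs

  position-edge : ∀ {v t} → t ∈ out G v → position v < position t
  position-edge {v} {t} t∈out-v with <-cmp (position v) (position t)
  ... | tri< v<t _ _ = v<t
  ... | tri≈ _ v≡t _ = ⊥-elim (acyclic G v [ subst (_∈ out G v) (sym (position-injective v≡t)) t∈out-v ])
  ... | tri> _ _ t>v = ⊥-elim (AllPairs-index vertexOrder-sorted (∈-vertexOrder t) (∈-vertexOrder v)
          (subst₂ _<_ (position≡index (∈-vertexOrder t)) (position≡index (∈-vertexOrder v)) t>v) t∈out-v)

startsAt? : ∀ c → Decidable (λ (e : ℕ × ℕ) → proj₁ e ≡ c)
startsAt? c e = proj₁ e ≟ c

successorsIn : ℕ → List (ℕ × ℕ) → List ℕ
successorsIn c = map proj₂ ∘ filter (startsAt? c)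

successorsIn-++ : ∀ c xs ys → successorsIn c (xs ++ ys) ≡ successorsIn c xs ++ successorsIn c ys
successorsIn-++ c xs ys =
  trans (cong (map proj₂) (filter-++ (startsAt? c) xs ys)) (map-++ proj₂ (filter (startsAt? c) xs) _)

successorsIn-absent : ∀ {c} xs → (∀ {e} → e ∈ xs → proj₁ e ≢ c) → successorsIn c xs ≡ []
successorsIn-absent {c} xs absent = cong (map proj₂) (filter-none (startsAt? c) (All.tabulate absent))

successorsIn-block : ∀ {A : Set} c (g : A → ℕ) ys → successorsIn c (map (λ t → c , g t) ys) ≡ map g ys
successorsIn-block c g ys = trans
  (cong (map proj₂) (filter-all (startsAt? c) (All-map⁺ (All.universal (λ _ → refl) ys))))
  (sym (map-∘ ys))

module EdgeCode {A : Set} (f : A → ℕ) (adj : A → List A) where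

  block : A → List (ℕ × ℕ)
  block v = map (λ t → f v , f t) (adj v)

  edgeCode : List A → List (ℕ × ℕ)
  edgeCode = concatMap block

  ∈-block⁻ : ∀ {e v} → e ∈ block v → ∃[ t ] t ∈ adj v × e ≡ (f v , f t)
  ∈-block⁻ = ∈-map⁻ _

  ∈-edgeCode⁻ : ∀ {e} vs → e ∈ edgeCode vs → ∃[ v ] ∃[ t ] v ∈ vs × t ∈ adj v × e ≡ (f v , f t)
  ∈-edgeCode⁻ (v ∷ vs) e∈ with ∈-++⁻ (block v) e∈
  ... | inj₁ e∈block with ∈-block⁻ e∈block
  ...   | t , t∈adj , refl = v , t , here refl , t∈adj , refl
  ∈-edgeCode⁻ (v ∷ vs) e∈ | inj₂ e∈rest with ∈-edgeCode⁻ vs e∈rest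
  ...   | w , t , w∈vs , t∈adj , refl = w , t , there w∈vs , t∈adj , refl

  length-edgeCode : ∀ vs → length (edgeCode vs) ≡ sum (map (length ∘ adj) vs)
  length-edgeCode []       = refl
  length-edgeCode (v ∷ vs) = trans (length-++ (block v)) (cong₂ _+_ (length-map _ (adj v)) (length-edgeCode vs))

  module _ (f-injective : Injective _≡_ _≡_ f) where

    edgeCode-unique : ∀ {vs} → Unique vs → (∀ v → Unique (adj v)) → Unique (edgeCode vs)
    edgeCode-unique {[]}     _                 _          = []
    edgeCode-unique {v ∷ vs} (v∉vs ∷ vs-unique) adj-unique =
      Unique.++⁺ (Unique.map⁺ (f-injective ∘ cong proj₂) (adj-unique v))
                 (edgeCode-unique vs-unique adj-unique) disjoint
      where
      disjoint : ∀ {e} → ¬ (e ∈ block v × e ∈ edgeCode vs)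
      disjoint (e∈block , e∈rest) with ∈-block⁻ e∈block | ∈-edgeCode⁻ vs e∈rest
      ... | _ , _ , refl | w , _ , w∈vs , _ , e≡ = All.lookup v∉vs w∈vs (f-injective (cong proj₁ e≡))

    successorsIn-edgeCode-∉ : ∀ {v} us → v ∉ us → successorsIn (f v) (edgeCode us) ≡ []
    successorsIn-edgeCode-∉ {v} us v∉us =
      successorsIn-absent (edgeCode us) λ e∈ → first≢ (∈-edgeCode⁻ us e∈)
      where
      first≢ : ∀ {e} → ∃[ u ] ∃[ t ] u ∈ us × t ∈ adj u × e ≡ (f u , f t) → proj₁ e ≢ f v
      first≢ (u , _ , u∈us , _ , refl) fu≡fv = v∉us (subst (_∈ us) (f-injective fu≡fv) u∈us)

    successorsIn-edgeCode : ∀ {v vs} → Unique vs → v ∈ vs → successorsIn (f v) (edgeCode vs) ≡ map f (adj v)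
    successorsIn-edgeCode {v} {w ∷ vs} (w∉vs ∷ vs-unique) v∈w∷vs =
      trans (successorsIn-++ (f v) (block w) (edgeCode vs)) (split v∈w∷vs)
      where
      split : v ∈ w ∷ vs → successorsIn (f v) (block w) ++ successorsIn (f v) (edgeCode vs) ≡ map f (adj v)
      split (here refl) = trans
        (cong₂ _++_ (successorsIn-block (f v) f (adj v))
                    (successorsIn-edgeCode-∉ vs λ v∈vs → All.lookup w∉vs v∈vs refl))
        (++-identityʳ _)
      split (there v∈vs) = cong₂ _++_
        (successorsIn-absent (block w) λ e∈ → first≢ (∈-block⁻ e∈))
        (successorsIn-edgeCode vs-unique v∈vs)
        where
        first≢ : ∀ {e} → ∃[ t ] t ∈ adj w × e ≡ (f w , f t) → proj₁ e ≢ f v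
        first≢ (_ , _ , refl) fw≡fv = All.lookup w∉vs v∈vs (f-injective fw≡fv)

code : ∀ {n} → DOAG n → List (ℕ × ℕ)
code {n} G = EdgeCode.edgeCode (position G) (out G) (allFin n)

module _ {n : ℕ} (G : DOAG n) where

  open EdgeCode (position G) (out G)

  code-unique : Unique (code G)
  code-unique = edgeCode-unique (position-injective G) (Unique.allFin⁺ n) (out-unique G)

  length-code : length (code G) ≡ edges G
  length-code = length-edgeCode (allFin n)

  successorsIn-code : ∀ v → successorsIn (position G v) (code G) ≡ map (position G) (out G v)
  successorsIn-code v = successorsIn-edgeCode (position-injective G) (Unique.allFin⁺ n) (∈-allFin v)

  code⊆edgeSlots : ∀ {k} → sources G ≡ k → code G ⊆ edgeSlots k (n ∸ k)
  code⊆edgeSlots refl e∈ with ∈-edgeCode⁻ (allFin n) e∈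
  ... | v , t , _ , t∈out-v , refl = ∈-edgeSlots (sources G) (n ∸ sources G) (position-edge G t∈out-v)
    (sources≤position G λ t∈srcs → srcs-sound G t t∈srcs v t∈out-v)
    (subst (position G t <_) (sym (m∸n+n≡m (unique⇒length≤ (srcs-unique G)))) (toℕ<n _))

codes≡⇒Iso : ∀ {n} (G H : DOAG n) → sources G ≡ sources H → code G ≡ code H → Iso G H
codes≡⇒Iso G H sG≡sH codeG≡codeH = σ , out-σ , srcs-σ
  where
  open ≡-Reasoning
  σ = label G ∘ₚ flip (label H)

  position-σ : ∀ v → position H (σ ⟨$⟩ʳ v) ≡ position G v
  position-σ v = cong toℕ (inverseʳ (label H))

  map-position-σ : ∀ vs → map (position H) (map (σ ⟨$⟩ʳ_) vs) ≡ map (position G) vs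
  map-position-σ vs = trans (sym (map-∘ vs)) (map-cong position-σ vs)

  out-σ : ∀ v → out H (σ ⟨$⟩ʳ v) ≡ map (σ ⟨$⟩ʳ_) (out G v)
  out-σ v = map-injective (position-injective H) (begin
    map (position H) (out H (σ ⟨$⟩ʳ v))            ≡⟨ successorsIn-code H (σ ⟨$⟩ʳ v) ⟨
    successorsIn (position H (σ ⟨$⟩ʳ v)) (code H)  ≡⟨ cong₂ successorsIn (position-σ v) (sym codeG≡codeH) ⟩
    successorsIn (position G v) (code G)           ≡⟨ successorsIn-code G v ⟩
    map (position G) (out G v)                     ≡⟨ map-position-σ (out G v) ⟨
    map (position H) (map (σ ⟨$⟩ʳ_) (out G v))     ∎)

  srcs-σ : srcs H ≡ map (σ ⟨$⟩ʳ_) (srcs G)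
  srcs-σ = map-injective (position-injective H) (begin
    map (position H) (srcs H)                  ≡⟨ map-position-srcs H ⟩
    upTo (sources H)                           ≡⟨ cong upTo sG≡sH ⟨
    upTo (sources G)                           ≡⟨ map-position-srcs G ⟨
    map (position G) (srcs G)                  ≡⟨ map-position-σ (srcs G) ⟨
    map (position H) (map (σ ⟨$⟩ʳ_) (srcs G))  ∎)

codes-unique : ∀ {n m k} {L : List (DOAG n)} → DistinctFamily n m k L → Unique (map code L)
codes-unique {L = []}    _ = []
codes-unique {m = m} {k} {G ∷ L} ((counts-G ∷ counts) , (¬isos-G ∷ ¬isos)) =
  All-map⁺ (All.zipWith distinct (counts , ¬isos-G)) ∷ codes-unique (counts , ¬isos)
  where
  distinct : ∀ {H} → (edges H ≡ m × sources H ≡ k) × ¬ Iso G H → code G ≢ code H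
  distinct {H} ((_ , sH≡k) , ¬G≅H) = ¬G≅H ∘ codes≡⇒Iso G H (trans (proj₂ counts-G) (sym sH≡k))

-- The bound holds for n = 0 as well.
lemma2p5 : (n m k : ℕ) → 1 ≤ n → (L : List (DOAG n)) →
    DistinctFamily n m k L → length L ≤ bound n m k
lemma2p5 n m k _ []            _ = z≤n
lemma2p5 n m k _ L@(G ∷ _) family@((counts-G ∷ _) , _) = begin
  length L                     ≡⟨ length-map code L ⟨
  length (map code L)          ≤⟨ unique∧⊆⇒length≤ (codes-unique family) codes⊆injections ⟩
  length (injections slots m)  ≡⟨ length-injections slots m ⟩
  length slots ↓ m             ≡⟨ cong (_↓ m) length-slots ⟩
  (n C 2 ∸ k C 2) ↓ m          ≤⟨ ↓≤C*! (n C 2 ∸ k C 2) m ⟩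
  bound n m k                  ∎
  where
  open ≤-Reasoning
  slots = edgeSlots k (n ∸ k)

  length-slots : length slots ≡ n C 2 ∸ k C 2
  length-slots = begin-equality
    length slots                   ≡⟨ m+n∸n≡m (length slots) (k C 2) ⟨
    length slots + k C 2 ∸ k C 2   ≡⟨ cong (_∸ k C 2) (length-edgeSlots k (n ∸ k)) ⟩
    (n ∸ k + k) C 2 ∸ k C 2        ≡⟨ cong (λ n′ → n′ C 2 ∸ k C 2) (m∸n+n≡m k≤n) ⟩
    n C 2 ∸ k C 2                  ∎
    where k≤n = subst (_≤ n) (proj₂ counts-G) (unique⇒length≤ (srcs-unique G))

  codes⊆injections : map code L ⊆ injections slots m
  codes⊆injections c∈ with ∈-map⁻ code c∈
  ... | H , H∈L , refl with All.lookup (proj₁ family) H∈L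
  ...   | edges≡m , sources≡k = subst (λ l → code H ∈ injections slots l) (trans (length-code H) edges≡m)
          (∈-injections (code-unique H) (code⊆edgeSlots H sources≡k))
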